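{- Let $n\ge 2$ and $A\subseteq[n]$. Then $f_n(A)\ge 2f_{n-1}(A)$ and $f_n(A)\ge 2^{n-1}$.
   Context: The set of alternatives is $[m]=\{1,\dots,m\}$ with its natural order. For a triple $i<j<k$, the never condition $1N3$ on a set of linear orders means that in every order, $i$ is not ranked last among $i,j,k$; $3N1$ means that $k$ is not ranked first among $i,j,k$. For $B\subseteq[m]$, the set-alternating scheme generated by $B$ assigns to each triple $i<j<k$ in $[m]$ the condition $1N3$ if $j\in B$ and $3N1$ if $j\notin B$; $D_{[m]}(B)$ is the set of all linear orders on $[m]$ satisfying all assigned conditions, and $f_m(B)=|D_{[m]}(B)|$. For a set $B$ of positive integers not contained in $[m]$, $f_m(B)$ means $f_m(B\cap[m])$ (so $f_{n-1}(A)=f_{n-1}(A\cap[n-1])$). -}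

module Defs where

open import Data.Bool using (Bool; true; false; _∧_; _∨_; not; if_then_else_)
open import Data.Nat using (ℕ; zero; suc; _≡ᵇ_; _<ᵇ_)
open import Data.List using (List; []; _∷_; map; concatMap; filterᵇ; length; upTo)
open import Data.Bool.ListAction using (all; any)

range : ℕ → List ℕ
range m = map suc (upTo m)

insertions : ℕ → List ℕ → List (List ℕ)
insertions x []       = (x ∷ []) ∷ []
insertions x (y ∷ ys) = (x ∷ y ∷ ys) ∷ map (y ∷_) (insertions x ys)

perms : List ℕ → List (List ℕ)
perms []       = [] ∷ []
perms (x ∷ xs) = concatMap (insertions x) (perms xs)

-- A linear order on [m] is represented as a permutation of 1,…,m listed
-- from the top-ranked alternative to the bottom-ranked one.
-- 'before σ a b' : a is ranked above b in σ.
before : List ℕ → ℕ → ℕ → Bool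
before []       a b = false
before (x ∷ xs) a b =
  if x ≡ᵇ a then any (_≡ᵇ b) xs
  else if x ≡ᵇ b then false
  else before xs a b

isLast : List ℕ → ℕ → ℕ → ℕ → Bool
isLast σ i j k = before σ j i ∧ before σ k i

isFirst : List ℕ → ℕ → ℕ → ℕ → Bool
isFirst σ i j k = before σ k i ∧ before σ k j

-- The condition assigned to triple i<j<k by the set-alternating scheme
-- generated by B: 1N3 if j ∈ B, 3N1 if j ∉ B.
tripleOK : (ℕ → Bool) → List ℕ → ℕ → ℕ → ℕ → Bool
tripleOK B σ i j k = if B j then not (isLast σ i j k) else not (isFirst σ i j k)

satisfies : ℕ → (ℕ → Bool) → List ℕ → Bool
satisfies m B σ =
  all (λ i → all (λ j → all (λ k →
    not ((i <ᵇ j) ∧ (j <ᵇ k)) ∨ tripleOK B σ i j k) (range m)) (range m)) (range m)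

-- D_[m](B) and f_m(B) = |D_[m](B)|.  Only the values of B on [m] are used,
-- so f m B = f_m(B ∩ [m]).
D : ℕ → (ℕ → Bool) → List (List ℕ)
D m B = filterᵇ (satisfies m B) (perms (range m))

f : ℕ → (ℕ → Bool) → ℕ
f m B = length (D m B)

-- Each ranking σ ∈ D_m(A) has two extensions in D_{m+1}(A): put m+1 at the bottom; or put m+1
-- directly below m when m ∉ A and m is not at the bottom of σ, and otherwise let m+1 take m's
-- place and move m to the bottom.  Every triple through m+1 then either behaves like the
-- corresponding triple through m in σ or is settled because one element sits at the bottom.
-- Deleting m+1 (after swapping m and m+1 back when m is at the bottom) recovers σ, so the
-- 2 f_m(A) extensions are distinct, and iterating from f_1(A) = 1 gives the power bound.
module Submission where

open import Defs
open import Data.Bool using (Bool; T; T?; true; false; not; _∧_; _∨_; if_then_else_)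
open import Data.Bool.Properties using (∧-zeroʳ)
open import Data.Bool.ListAction using (all; any)
open import Data.Empty using (⊥-elim)
open import Data.List using (List; []; _∷_; _++_; _∷ʳ_; [_]; map; filter; concatMap; length; upTo)
open import Data.List.Properties using (++-assoc; ∷-injective; upTo-∷ʳ; map-++; map-∘; map-cong; map-id; map-id-local; filter-all; filter-reject; filter-accept; filter-++; ++-identityʳ)
open import Data.List.Membership.Propositional using (_∈_; find; lose)
open import Data.List.Membership.Propositional.Properties using (∈-map⁻; ∈-map⁺; ∈-upTo⁻; ∈-upTo⁺; ∈-++⁻; ∈-++⁺ˡ; ∈-++⁺ʳ; ∈-∃++; ∈-concatMap⁻; ∈-concatMap⁺; ∈-filter⁺; ∈-filter⁻)
open import Data.List.Relation.Binary.Subset.Propositional using (_⊆_)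
open import Data.List.Relation.Unary.All as All using (All; []; _∷_)
open import Data.List.Relation.Unary.All.Properties using (all⁺; all⁻)
open import Data.List.Relation.Unary.Any using (here; there)
open import Data.List.Relation.Unary.AllPairs using ([]; _∷_)
open import Data.List.Relation.Unary.Unique.Propositional using (Unique)
import Data.List.Relation.Unary.Unique.Propositional.Properties as Unique
open import Data.List.Relation.Binary.Permutation.Propositional using (_↭_; ↭-sym; ↭⇒↭ₛ; module PermutationReasoning)
import Data.List.Relation.Binary.Permutation.Propositional as ↭
open import Data.List.Relation.Binary.Permutation.Propositional.Properties using (∈-resp-↭; ↭-length; shift; drop-mid; ++⁺ʳ; ++⁺ˡ; map⁺; ∷↭∷ʳ)
import Data.List.Relation.Binary.Permutation.Setoid.Properties as PermutationSetoid
open import Data.Nat using (ℕ; zero; suc; _≤_; _<_; _≥_; _*_; _^_; _∸_; _≡ᵇ_; z≤n; s≤s; s≤s⁻¹)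
open import Data.Nat.Properties using (module ≤-Reasoning; _≟_; *-suc; <⇒<ᵇ; <ᵇ⇒<; <⇒≢; <⇒≤; ≤-refl; ≤-trans; <-trans; n≤1+n; m≤n⇒m≤1+n; m≤n⇒m<n∨m≡n; suc-injective; *-monoʳ-≤)
open import Data.Product using (_×_; _,_; proj₁; proj₂)
open import Data.Sum using (_⊎_; inj₁; inj₂)
open import Function using (_∘_; mk⇔)
open import Relation.Binary.PropositionalEquality using (setoid; _≡_; _≢_; refl; sym; trans; cong; cong₂; subst; module ≡-Reasoning)
open import Relation.Nullary using (¬_; ¬?; yes; no)
open import Relation.Nullary.Decidable using (dec-true; dec-false; does-⇔)

private
  variable
    a b x y z ℓ ℓ′ : ℕ
    σ τ : List ℕ
    B : ℕ → Bool

≡ᵇ-true : a ≡ b → (a ≡ᵇ b) ≡ true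
≡ᵇ-true {a} {b} = dec-true (a ≟ b)

≡ᵇ-false : a ≢ b → (a ≡ᵇ b) ≡ false
≡ᵇ-false {a} {b} = dec-false (a ≟ b)

≡ᵇ-refl : ∀ a → (a ≡ᵇ a) ≡ true
≡ᵇ-refl a = ≡ᵇ-true {a} refl

any-≡ᵇ-∷ʳ : ∀ σ → z ≢ b → any (_≡ᵇ b) (σ ∷ʳ z) ≡ any (_≡ᵇ b) σ
any-≡ᵇ-∷ʳ [] z≢b rewrite ≡ᵇ-false z≢b = refl
any-≡ᵇ-∷ʳ {b = b} (x ∷ σ) z≢b with x ≡ᵇ b
... | true  = refl
... | false = any-≡ᵇ-∷ʳ σ z≢b

before-∷ʳ : ∀ σ → a ≢ z → b ≢ z → before (σ ∷ʳ z) a b ≡ before σ a b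
before-∷ʳ [] a≢z b≢z rewrite ≡ᵇ-false (a≢z ∘ sym) | ≡ᵇ-false (b≢z ∘ sym) = refl
before-∷ʳ {a} {b = b} (x ∷ σ) a≢z b≢z with x ≡ᵇ a
... | true = any-≡ᵇ-∷ʳ σ (b≢z ∘ sym)
... | false with x ≡ᵇ b
...   | true  = refl
...   | false = before-∷ʳ σ a≢z b≢z

before-∷ʳ-bottom : ∀ σ → All (_≢ z) σ → before (σ ∷ʳ z) z b ≡ false
before-∷ʳ-bottom {z} [] [] rewrite ≡ᵇ-refl z = refl
before-∷ʳ-bottom {b = b} (x ∷ σ) (x≢z ∷ z∉σ) rewrite ≡ᵇ-false x≢z with x ≡ᵇ b
... | true  = refl
... | false = before-∷ʳ-bottom σ z∉σ

module _ {π : ℕ → ℕ} (π-involutive : ∀ x → π (π x) ≡ x) where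

  ≡ᵇ-involution : ∀ x y → (π x ≡ᵇ y) ≡ (x ≡ᵇ π y)
  ≡ᵇ-involution x y = does-⇔ (mk⇔ (λ e → trans (sym (π-involutive x)) (cong π e))
                                   (λ e → trans (cong π e) (π-involutive y)))
                             (π x ≟ y) (x ≟ π y)

  any-≡ᵇ-map : ∀ σ b → any (_≡ᵇ b) (map π σ) ≡ any (_≡ᵇ π b) σ
  any-≡ᵇ-map []      b = refl
  any-≡ᵇ-map (x ∷ σ) b rewrite ≡ᵇ-involution x b | any-≡ᵇ-map σ b = refl

  before-map : ∀ σ a b → before (map π σ) a b ≡ before σ (π a) (π b)
  before-map []      a b = refl
  before-map (x ∷ σ) a b
    rewrite ≡ᵇ-involution x a | ≡ᵇ-involution x b | any-≡ᵇ-map σ b | before-map σ a b = refl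

  map-involutive : ∀ σ → map π (map π σ) ≡ σ
  map-involutive σ = trans (sym (map-∘ σ)) (trans (map-cong π-involutive σ) (map-id σ))

insertBelow : ℕ → ℕ → List ℕ → List ℕ
insertBelow x y []      = []
insertBelow x y (z ∷ σ) = if z ≡ᵇ x then z ∷ y ∷ σ else z ∷ insertBelow x y σ

any-≡ᵇ-insertBelow : ∀ σ → y ≢ b → any (_≡ᵇ b) (insertBelow x y σ) ≡ any (_≡ᵇ b) σ
any-≡ᵇ-insertBelow [] y≢b = refl
any-≡ᵇ-insertBelow {x = x} (z ∷ σ) y≢b with z ≡ᵇ x
... | true rewrite ≡ᵇ-false y≢b = refl
... | false rewrite any-≡ᵇ-insertBelow {x = x} σ y≢b = refl

before-insertBelow : ∀ σ → a ≢ y → b ≢ y → before (insertBelow x y σ) a b ≡ before σ a b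
before-insertBelow [] a≢y b≢y = refl
before-insertBelow {a} {b = b} {x} (z ∷ σ) a≢y b≢y with z ≡ᵇ x
... | true with z ≡ᵇ a
...   | true rewrite ≡ᵇ-false (b≢y ∘ sym) = refl
...   | false with z ≡ᵇ b
...     | true  = refl
...     | false rewrite ≡ᵇ-false (a≢y ∘ sym) | ≡ᵇ-false (b≢y ∘ sym) = refl
before-insertBelow {a} {b = b} (z ∷ σ) a≢y b≢y | false with z ≡ᵇ a
... | true = any-≡ᵇ-insertBelow σ (b≢y ∘ sym)
... | false with z ≡ᵇ b
...   | true  = refl
...   | false = before-insertBelow σ a≢y b≢y

before-insertBelow-inserted : ∀ σ → x ≢ y → b ≢ x → All (_≢ y) σ →
                              before (insertBelow x y σ) y b ≡ before σ x b
before-insertBelow-inserted [] x≢y b≢x [] = refl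
before-insertBelow-inserted {x} {y} {b} (z ∷ σ) x≢y b≢x (z≢y ∷ y∉σ) with z ≟ x
... | yes refl rewrite ≡ᵇ-refl z | ≡ᵇ-false x≢y | ≡ᵇ-false (b≢x ∘ sym) | ≡ᵇ-refl y = refl
... | no z≢x rewrite ≡ᵇ-false z≢x | ≡ᵇ-false z≢y with z ≡ᵇ b
...   | true  = refl
...   | false = before-insertBelow-inserted σ x≢y b≢x y∉σ

before-insertBelow-anchor : ∀ σ → x ≢ y → All (_≢ y) σ → before (insertBelow x y σ) y x ≡ false
before-insertBelow-anchor [] x≢y [] = refl
before-insertBelow-anchor {x} (z ∷ σ) x≢y (z≢y ∷ y∉σ) with z ≟ x
... | yes refl rewrite ≡ᵇ-refl z | ≡ᵇ-false x≢y | ≡ᵇ-refl z = refl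
... | no z≢x rewrite ≡ᵇ-false z≢x | ≡ᵇ-false z≢y | ≡ᵇ-false z≢x =
  before-insertBelow-anchor σ x≢y y∉σ

insertBelow-↭ : ∀ σ → x ∈ σ → insertBelow x y σ ↭ y ∷ σ
insertBelow-↭ {x} {y} (z ∷ σ) x∈ with z ≟ x
... | yes refl rewrite ≡ᵇ-refl z = ↭.swap z y ↭.refl
insertBelow-↭ (z ∷ σ) (here refl)  | no z≢x = ⊥-elim (z≢x refl)
insertBelow-↭ {y = y} (z ∷ σ) (there x∈σ) | no z≢x rewrite ≡ᵇ-false z≢x =
  ↭.trans (↭.prep z (insertBelow-↭ σ x∈σ)) (↭.swap z y ↭.refl)

lastOr : ℕ → List ℕ → ℕ
lastOr d []      = d
lastOr d (x ∷ σ) = lastOr x σ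

lastOr-∷ʳ : ∀ d σ z → lastOr d (σ ∷ʳ z) ≡ z
lastOr-∷ʳ d []      z = refl
lastOr-∷ʳ d (x ∷ σ) z = lastOr-∷ʳ x σ z

lastOr-∈ : ∀ d σ → x ∈ σ → lastOr d σ ∈ σ
lastOr-∈ d (y ∷ [])    _ = here refl
lastOr-∈ d (y ∷ z ∷ σ) _ = there (lastOr-∈ y (z ∷ σ) (here refl))

lastOr-insertBelow : ∀ d σ → lastOr d σ ≢ x → lastOr d (insertBelow x y σ) ≡ lastOr d σ
lastOr-insertBelow d []      last≢x = refl
lastOr-insertBelow {x} d (z ∷ σ) last≢x with z ≟ x
lastOr-insertBelow d (z ∷ [])    last≢x | yes refl = ⊥-elim (last≢x refl)
lastOr-insertBelow d (z ∷ w ∷ σ) last≢x | yes refl rewrite ≡ᵇ-refl z = refl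
... | no z≢x rewrite ≡ᵇ-false z≢x = lastOr-insertBelow z σ last≢x

before-lastOr : ∀ d σ b → Unique σ → before σ (lastOr d σ) b ≡ false
before-lastOr d []          b u = refl
before-lastOr d (x ∷ [])    b u rewrite ≡ᵇ-refl x = refl
before-lastOr d (x ∷ y ∷ σ) b (x∉ ∷ u)
  rewrite ≡ᵇ-false (All.lookup x∉ (lastOr-∈ x (y ∷ σ) (here refl))) with x ≡ᵇ b
... | true  = refl
... | false = before-lastOr x (y ∷ σ) b u

transpose : ℕ → ℕ → ℕ → ℕ
transpose a b x = if x ≡ᵇ a then b else if x ≡ᵇ b then a else x

transpose-left : ∀ a b → transpose a b a ≡ b
transpose-left a b rewrite ≡ᵇ-refl a = refl

transpose-right : ∀ a b → transpose a b b ≡ a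
transpose-right a b with b ≟ a
... | yes refl rewrite ≡ᵇ-refl b = refl
... | no b≢a rewrite ≡ᵇ-false b≢a | ≡ᵇ-refl b = refl

transpose-fix : x ≢ a → x ≢ b → transpose a b x ≡ x
transpose-fix x≢a x≢b rewrite ≡ᵇ-false x≢a | ≡ᵇ-false x≢b = refl

transpose-involutive : ∀ a b x → transpose a b (transpose a b x) ≡ x
transpose-involutive a b x with x ≟ a | x ≟ b
... | yes refl | _        rewrite transpose-left x b  = transpose-right x b
... | no _     | yes refl rewrite transpose-right a x = transpose-left a x
... | no x≢a   | no x≢b   rewrite transpose-fix x≢a x≢b = transpose-fix x≢a x≢b

delete : ℕ → List ℕ → List ℕ
delete y = filter (λ x → ¬? (x ≟ y))

delete-head : ∀ y σ → delete y (y ∷ σ) ≡ delete y σ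
delete-head y σ = filter-reject (λ x → ¬? (x ≟ y)) (λ y≢y → y≢y refl)

delete-keep : ∀ σ → x ≢ y → delete y (x ∷ σ) ≡ x ∷ delete y σ
delete-keep {y = y} σ = filter-accept (λ x → ¬? (x ≟ y))

delete-fresh : All (_≢ y) σ → delete y σ ≡ σ
delete-fresh {y} = filter-all (λ x → ¬? (x ≟ y))

delete-∷ʳ : ∀ σ → All (_≢ y) σ → delete y (σ ∷ʳ y) ≡ σ
delete-∷ʳ {y} σ y∉σ = begin
  delete y (σ ++ [ y ])         ≡⟨ filter-++ (λ x → ¬? (x ≟ y)) σ [ y ] ⟩
  delete y σ ++ delete y [ y ]  ≡⟨ cong₂ _++_ (delete-fresh y∉σ) (delete-head y []) ⟩
  σ ++ []                       ≡⟨ ++-identityʳ σ ⟩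
  σ                             ∎
  where open ≡-Reasoning

delete-insertBelow : ∀ σ → All (_≢ y) σ → delete y (insertBelow x y σ) ≡ σ
delete-insertBelow [] [] = refl
delete-insertBelow {y} {x} (z ∷ σ) (z≢y ∷ y∉σ) with z ≡ᵇ x
... | true  = trans (delete-keep (y ∷ σ) z≢y) (cong (z ∷_) (trans (delete-head y σ) (delete-fresh y∉σ)))
... | false = trans (delete-keep _ z≢y) (cong (z ∷_) (delete-insertBelow σ y∉σ))

Unique-resp-↭ : σ ↭ τ → Unique σ → Unique τ
Unique-resp-↭ p = PermutationSetoid.Unique-resp-↭ (setoid ℕ) (↭⇒↭ₛ p)

∈-range⁻ : x ∈ range ℓ → 1 ≤ x × x ≤ ℓ
∈-range⁻ x∈ with ∈-map⁻ suc x∈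
... | _ , y∈ , refl = s≤s z≤n , ∈-upTo⁻ y∈

∈-range⁺ : 1 ≤ x → x ≤ ℓ → x ∈ range ℓ
∈-range⁺ {suc _} (s≤s _) x≤ℓ = ∈-map⁺ suc (∈-upTo⁺ x≤ℓ)

range-suc : ∀ ℓ → range (suc ℓ) ≡ range ℓ ∷ʳ suc ℓ
range-suc ℓ = trans (cong (map suc) (sym (upTo-∷ʳ ℓ))) (map-++ suc (upTo ℓ) [ ℓ ])

Unique-range : ∀ ℓ → Unique (range ℓ)
Unique-range ℓ = Unique.map⁺ suc-injective (Unique.upTo⁺ ℓ)

Unique⇒length≤ : ∀ {X : Set} {xs ys : List X} → Unique xs → xs ⊆ ys → length xs ≤ length ys
Unique⇒length≤ {xs = []}     _             _     = z≤n
Unique⇒length≤ {xs = x ∷ xs} {ys} (x∉xs ∷ u) xs⊆ys with ∈-∃++ (xs⊆ys (here refl))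
... | as , bs , refl = begin
  suc (length xs)          ≤⟨ s≤s (Unique⇒length≤ u xs⊆as++bs) ⟩
  suc (length (as ++ bs))  ≡⟨ ↭-length (shift x as bs) ⟨
  length (as ++ x ∷ bs)    ∎
  where
  open ≤-Reasoning
  xs⊆as++bs : xs ⊆ as ++ bs
  xs⊆as++bs w∈xs with ∈-++⁻ as (xs⊆ys (there w∈xs))
  ... | inj₁ w∈as         = ∈-++⁺ˡ w∈as
  ... | inj₂ (here refl)  = ⊥-elim (All.lookup x∉xs w∈xs refl)
  ... | inj₂ (there w∈bs) = ∈-++⁺ʳ as w∈bs

Unique-concatMap⁺ : ∀ {X Y : Set} (h : Y → List X) (g : X → Y) {ys : List Y} → Unique ys →
                    (∀ {y} → y ∈ ys → Unique (h y)) →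
                    (∀ {y x} → y ∈ ys → x ∈ h y → g x ≡ y) →
                    Unique (concatMap h ys)
Unique-concatMap⁺ h g {[]}     _          _        _       = []
Unique-concatMap⁺ h g {y ∷ ys} (y∉ys ∷ u) unique-h g-inverse =
  Unique.++⁺ (unique-h (here refl))
             (Unique-concatMap⁺ h g u (unique-h ∘ there) (g-inverse ∘ there))
             disjoint
  where
  disjoint : ∀ {x} → ¬ (x ∈ h y × x ∈ concatMap h ys)
  disjoint (x∈hy , x∈rest) with find (∈-concatMap⁻ h {xs = ys} x∈rest)
  ... | y′ , y′∈ys , x∈hy′ =
    All.lookup y∉ys y′∈ys (trans (sym (g-inverse (here refl) x∈hy)) (g-inverse (there y′∈ys) x∈hy′))

∈-insertions⁻ : τ ∈ insertions x σ → τ ↭ x ∷ σ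
∈-insertions⁻ {σ = []}    (here refl) = ↭.refl
∈-insertions⁻ {σ = _ ∷ _} (here refl) = ↭.refl
∈-insertions⁻ {x = x} {σ = y ∷ σ} (there τ∈) with ∈-map⁻ (y ∷_) τ∈
... | _ , τ′∈ , refl = ↭.trans (↭.prep y (∈-insertions⁻ τ′∈)) (↭.swap y x ↭.refl)

∈-insertions⁺ : ∀ σ₁ x σ₂ → σ₁ ++ x ∷ σ₂ ∈ insertions x (σ₁ ++ σ₂)
∈-insertions⁺ []       x []      = here refl
∈-insertions⁺ []       x (_ ∷ _) = here refl
∈-insertions⁺ (y ∷ σ₁) x σ₂      = there (∈-map⁺ (y ∷_) (∈-insertions⁺ σ₁ x σ₂))

delete-insertions : τ ∈ insertions x σ → All (_≢ x) σ → delete x τ ≡ σ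
delete-insertions {x = x} {σ = []}    (here refl) [] = delete-head x []
delete-insertions {x = x} {σ = _ ∷ _} (here refl) x∉ = trans (delete-head x _) (delete-fresh x∉)
delete-insertions {σ = y ∷ σ} (there τ∈) (y≢x ∷ x∉σ) with ∈-map⁻ (y ∷_) τ∈
... | _ , τ′∈ , refl = trans (delete-keep _ y≢x) (cong (y ∷_) (delete-insertions τ′∈ x∉σ))

Unique-insertions : ∀ x σ → All (_≢ x) σ → Unique (insertions x σ)
Unique-insertions x []      []         = [] ∷ []
Unique-insertions x (y ∷ σ) (y≢x ∷ x∉σ) =
  All.tabulate head-differs ∷ Unique.map⁺ (λ e → proj₂ (∷-injective e)) (Unique-insertions x σ x∉σ)
  where
  head-differs : τ ∈ map (y ∷_) (insertions x σ) → x ∷ y ∷ σ ≢ τ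
  head-differs τ∈ e with ∈-map⁻ (y ∷_) τ∈
  ... | _ , _ , refl = y≢x (sym (proj₁ (∷-injective e)))

∈-perms⁻ : τ ∈ perms σ → τ ↭ σ
∈-perms⁻ {σ = []}    (here refl) = ↭.refl
∈-perms⁻ {σ = x ∷ σ} τ∈ with find (∈-concatMap⁻ (insertions x) {xs = perms σ} τ∈)
... | _ , τ′∈ , τ∈ins = ↭.trans (∈-insertions⁻ τ∈ins) (↭.prep x (∈-perms⁻ τ′∈))

∈-perms⁺ : ∀ σ → τ ↭ σ → τ ∈ perms σ
∈-perms⁺ {[]}    []      _ = here refl
∈-perms⁺ {_ ∷ _} []      p with ∈-resp-↭ p (here refl)
... | ()
∈-perms⁺ (x ∷ σ) p with ∈-∃++ (∈-resp-↭ (↭-sym p) (here {x = x} refl))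
... | σ₁ , σ₂ , refl =
  ∈-concatMap⁺ (insertions x) (lose (∈-perms⁺ σ (drop-mid σ₁ [] p)) (∈-insertions⁺ σ₁ x σ₂))

Unique-perms : ∀ σ → Unique σ → Unique (perms σ)
Unique-perms []      _          = [] ∷ []
Unique-perms (x ∷ σ) (x∉σ ∷ u) =
  Unique-concatMap⁺ (insertions x) (delete x) (Unique-perms σ u)
    (λ τ∈ → Unique-insertions x _ (fresh τ∈)) (λ τ∈ ρ∈ → delete-insertions ρ∈ (fresh τ∈))
  where
  fresh : τ ∈ perms σ → All (_≢ x) τ
  fresh τ∈ = All.tabulate (λ y∈τ y≡x → All.lookup x∉σ (∈-resp-↭ (∈-perms⁻ τ∈) y∈τ) (sym y≡x))

Sat : ℕ → (ℕ → Bool) → List ℕ → Set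
Sat ℓ B τ = ∀ {i j k} → 1 ≤ i → i < j → j < k → k ≤ ℓ → T (tripleOK B τ i j k)

satisfies⇒Sat : ∀ ℓ B τ → T (satisfies ℓ B τ) → Sat ℓ B τ
satisfies⇒Sat ℓ B τ sat 1≤i i<j j<k k≤ℓ =
  guarded (<⇒<ᵇ i<j) (<⇒<ᵇ j<k) (entry _ (entry _ (entry _ sat (∈-range⁺ 1≤i i≤ℓ)) (∈-range⁺ 1≤j j≤ℓ)) (∈-range⁺ 1≤k k≤ℓ))
  where
  entry : ∀ (p : ℕ → Bool) {x} → T (all p (range ℓ)) → x ∈ range ℓ → T (p x)
  entry p t = All.lookup (all⁺ p (range ℓ) t)
  guarded : ∀ {a b c} → T a → T b → T (not (a ∧ b) ∨ c) → T c
  guarded {true} {true} _ _ t = t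
  j≤ℓ = ≤-trans (<⇒≤ j<k) k≤ℓ
  i≤ℓ = ≤-trans (<⇒≤ i<j) j≤ℓ
  1≤j = ≤-trans 1≤i (<⇒≤ i<j)
  1≤k = ≤-trans 1≤j (<⇒≤ j<k)

Sat⇒satisfies : ∀ ℓ B τ → Sat ℓ B τ → T (satisfies ℓ B τ)
Sat⇒satisfies ℓ B τ S =
  every _ λ i∈ → every _ λ _ → every _ λ k∈ →
    guarded (λ i<j j<k → S (proj₁ (∈-range⁻ i∈)) (<ᵇ⇒< _ _ i<j) (<ᵇ⇒< _ _ j<k) (proj₂ (∈-range⁻ k∈)))
  where
  every : ∀ (p : ℕ → Bool) → (∀ {x} → x ∈ range ℓ → T (p x)) → T (all p (range ℓ))
  every p h = all⁻ p {xs = range ℓ} (All.tabulate h)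
  guarded : ∀ {a b c} → (T a → T b → T c) → T (not (a ∧ b) ∨ c)
  guarded {true}  {true}  t = t _ _
  guarded {true}  {false} _ = _
  guarded {false}         _ = _

∈-D⁻ : τ ∈ D ℓ B → τ ↭ range ℓ × Sat ℓ B τ
∈-D⁻ {τ} {ℓ} {B} τ∈ with ∈-filter⁻ (T? ∘ satisfies ℓ B) {xs = perms (range ℓ)} τ∈
... | τ∈perms , sat = ∈-perms⁻ τ∈perms , satisfies⇒Sat ℓ B τ sat

∈-D⁺ : ∀ ℓ B {τ} → τ ↭ range ℓ → Sat ℓ B τ → τ ∈ D ℓ B
∈-D⁺ ℓ B {τ} p S = ∈-filter⁺ (T? ∘ satisfies ℓ B) (∈-perms⁺ (range ℓ) p) (Sat⇒satisfies ℓ B τ S)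

Unique-D : ∀ ℓ B → Unique (D ℓ B)
Unique-D ℓ B = Unique.filter⁺ (T? ∘ satisfies ℓ B) (Unique-perms (range ℓ) (Unique-range ℓ))

module _ (B : ℕ → Bool) (τ : List ℕ) {i j k : ℕ} where

  tripleOK-below : before τ k i ≡ false → T (tripleOK B τ i j k)
  tripleOK-below k⊀i with B j
  ... | true  rewrite k⊀i | ∧-zeroʳ (before τ j i) = _
  ... | false rewrite k⊀i = _

  tripleOK-1N3 : B j ≡ true → before τ j i ≡ false → T (tripleOK B τ i j k)
  tripleOK-1N3 j∈B j⊀i rewrite j∈B | j⊀i = _

  tripleOK-3N1 : B j ≡ false → before τ k j ≡ false → T (tripleOK B τ i j k)
  tripleOK-3N1 j∉B k⊀j rewrite j∉B | k⊀j | ∧-zeroʳ (before τ k i) = _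

  tripleOK-transfer : ∀ σ k′ → before τ j i ≡ before σ j i → before τ k i ≡ before σ k′ i →
                      before τ k j ≡ before σ k′ j → tripleOK B τ i j k ≡ tripleOK B σ i j k′
  tripleOK-transfer σ k′ ji ki kj rewrite ji | ki | kj = refl

-- tripleOK only inspects pairs whose larger element is named first.
AgreeOn : ℕ → List ℕ → List ℕ → Set
AgreeOn ℓ τ σ = ∀ {a b} → a < b → b ≤ ℓ → before τ b a ≡ before σ b a

Sat-transfer : ∀ B τ σ → ℓ ≤ ℓ′ → Sat ℓ′ B σ → AgreeOn ℓ τ σ → Sat ℓ B τ
Sat-transfer B τ σ ℓ≤ℓ′ S agree {k = k} 1≤i i<j j<k k≤ℓ =
  subst T (sym (tripleOK-transfer B τ σ k (agree i<j (≤-trans (<⇒≤ j<k) k≤ℓ))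
                                          (agree (<-trans i<j j<k) k≤ℓ) (agree j<k k≤ℓ)))
        (S 1≤i i<j j<k (≤-trans k≤ℓ ℓ≤ℓ′))

Sat-suc : ∀ B τ → Sat ℓ B τ →
          (∀ {i j} → 1 ≤ i → i < j → j ≤ ℓ → T (tripleOK B τ i j (suc ℓ))) → Sat (suc ℓ) B τ
Sat-suc B τ S top 1≤i i<j j<k k≤1+ℓ with m≤n⇒m<n∨m≡n k≤1+ℓ
... | inj₁ k<1+ℓ = S 1≤i i<j j<k (s≤s⁻¹ k<1+ℓ)
... | inj₂ refl  = top 1≤i i<j (s≤s⁻¹ j<k)

-- t plays in τ the role that suc ℓ plays in σ, so triples through t reduce to triples in σ.
tripleOK-surrogate : ∀ B τ σ t → Sat (suc ℓ) B σ → AgreeOn ℓ τ σ →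
                     (∀ {a} → a ≤ ℓ → before τ t a ≡ before σ (suc ℓ) a) →
                     (∀ {i} → 1 ≤ i → i ≤ ℓ → T (tripleOK B τ i (suc ℓ) t)) →
                     ∀ {i j} → 1 ≤ i → i < j → j ≤ suc ℓ → T (tripleOK B τ i j t)
tripleOK-surrogate {ℓ} B τ σ t S agree surrogate top {i} {j} 1≤i i<j j≤1+ℓ with m≤n⇒m<n∨m≡n j≤1+ℓ
... | inj₁ j<1+ℓ = subst T (sym (tripleOK-transfer B τ σ (suc ℓ)
                             (agree i<j j≤ℓ) (surrogate (≤-trans (<⇒≤ i<j) j≤ℓ)) (surrogate j≤ℓ)))
                           (S 1≤i i<j j<1+ℓ ≤-refl)
  where j≤ℓ = s≤s⁻¹ j<1+ℓ
... | inj₂ refl  = top 1≤i (s≤s⁻¹ i<j)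

module Doubling (k : ℕ) (A : ℕ → Bool) where

  m : ℕ
  m = suc k

  n : ℕ
  n = suc m

  m≢n : m ≢ n
  m≢n = <⇒≢ ≤-refl

  ≤m⇒≢n : x ≤ m → x ≢ n
  ≤m⇒≢n x≤m = <⇒≢ (s≤s x≤m)

  ≤k⇒≢m : x ≤ k → x ≢ m
  ≤k⇒≢m x≤k = <⇒≢ (s≤s x≤k)

  π : ℕ → ℕ
  π = transpose m n

  π-fix : x ≤ k → π x ≡ x
  π-fix x≤k = transpose-fix (≤k⇒≢m x≤k) (≤m⇒≢n (m≤n⇒m≤1+n x≤k))

  -- n takes the place of m, and m moves to the bottom.
  demote : List ℕ → List ℕ
  demote σ = map π (σ ∷ʳ n)

  extend₁ : List ℕ → List ℕ
  extend₁ σ = σ ∷ʳ n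

  extend₂ : List ℕ → List ℕ
  extend₂ σ = if A m ∨ (lastOr 0 σ ≡ᵇ m) then demote σ else insertBelow m n σ

  extensions : List ℕ → List (List ℕ)
  extensions σ = extend₁ σ ∷ extend₂ σ ∷ []

  restore : List ℕ → List ℕ
  restore τ = delete n (if lastOr 0 τ ≡ᵇ m then map π τ else τ)

  extend₂-cases : ∀ σ → (extend₂ σ ≡ demote σ × (A m ≡ true ⊎ lastOr 0 σ ≡ m))
                      ⊎ (extend₂ σ ≡ insertBelow m n σ × A m ≡ false × lastOr 0 σ ≢ m)
  extend₂-cases σ with A m | lastOr 0 σ ≟ m
  ... | true  | _                                       = inj₁ (refl , inj₁ refl)
  ... | false | yes last≡m rewrite ≡ᵇ-true last≡m  = inj₁ (refl , inj₂ last≡m)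
  ... | false | no last≢m  rewrite ≡ᵇ-false last≢m = inj₂ (refl , refl , last≢m)

  n∉ : σ ↭ range m → All (_≢ n) σ
  n∉ p = All.tabulate (λ x∈σ → ≤m⇒≢n (proj₂ (∈-range⁻ (∈-resp-↭ p x∈σ))))

  m∈ : σ ↭ range m → m ∈ σ
  m∈ p = ∈-resp-↭ (↭-sym p) (∈-range⁺ (s≤s z≤n) ≤-refl)

  ↭-range⇒Unique : σ ↭ range m → Unique σ
  ↭-range⇒Unique p = Unique-resp-↭ (↭-sym p) (Unique-range m)

  Sat-extend₁ : ∀ σ → Sat m A σ → All (_≢ n) σ → Sat n A (extend₁ σ)
  Sat-extend₁ σ S n∉σ =
    Sat-suc A ρ (Sat-transfer A ρ σ ≤-refl S agree)
      (λ _ _ _ → tripleOK-below A ρ (before-∷ʳ-bottom σ n∉σ))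
    where
    ρ = extend₁ σ
    agree : AgreeOn m ρ σ
    agree a<b b≤m = before-∷ʳ σ (≤m⇒≢n b≤m) (≤m⇒≢n (≤-trans (<⇒≤ a<b) b≤m))

  Sat-insertBelow : ∀ σ → Sat m A σ → All (_≢ n) σ → A m ≡ false → Sat n A (insertBelow m n σ)
  Sat-insertBelow σ S n∉σ m∉A =
    Sat-suc A ρ (Sat-transfer A ρ σ ≤-refl S agree)
      (tripleOK-surrogate A ρ σ n S (λ a<b b≤k → agree a<b (m≤n⇒m≤1+n b≤k)) surrogate
        (λ _ _ → tripleOK-3N1 A ρ m∉A (before-insertBelow-anchor σ m≢n n∉σ)))
    where
    ρ = insertBelow m n σ
    agree : AgreeOn m ρ σ
    agree a<b b≤m = before-insertBelow σ (≤m⇒≢n b≤m) (≤m⇒≢n (≤-trans (<⇒≤ a<b) b≤m))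
    surrogate : a ≤ k → before ρ n a ≡ before σ m a
    surrogate a≤k = before-insertBelow-inserted σ m≢n (≤k⇒≢m a≤k) n∉σ

  before-demote : ∀ σ a b → before (demote σ) a b ≡ before (σ ∷ʳ n) (π a) (π b)
  before-demote σ = before-map (transpose-involutive m n) (σ ∷ʳ n)

  Sat-demote : ∀ σ → Sat m A σ → All (_≢ n) σ → Unique σ → A m ≡ true ⊎ lastOr 0 σ ≡ m →
               Sat n A (demote σ)
  Sat-demote σ S n∉σ u demotable =
    Sat-suc A ρ (Sat-suc A ρ (Sat-transfer A ρ σ (n≤1+n k) S agree)
                  (λ _ i<j j≤k → tripleOK-below A ρ (m-bottom (≤-trans (<⇒≤ i<j) j≤k))))
      (tripleOK-surrogate A ρ σ n S agree surrogate (top demotable))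
    where
    ρ = demote σ
    agree : AgreeOn k ρ σ
    agree {a} {b} a<b b≤k = begin
      before ρ b a                  ≡⟨ before-demote σ b a ⟩
      before (σ ∷ʳ n) (π b) (π a)   ≡⟨ cong₂ (before (σ ∷ʳ n)) (π-fix b≤k) (π-fix a≤k) ⟩
      before (σ ∷ʳ n) b a           ≡⟨ before-∷ʳ σ (≤m⇒≢n (m≤n⇒m≤1+n b≤k)) (≤m⇒≢n (m≤n⇒m≤1+n a≤k)) ⟩
      before σ b a                  ∎
      where
      open ≡-Reasoning
      a≤k = ≤-trans (<⇒≤ a<b) b≤k
    m-bottom : a ≤ k → before ρ m a ≡ false
    m-bottom {a} a≤k = trans (before-demote σ m a)
      (trans (cong₂ (before (σ ∷ʳ n)) (transpose-left m n) (π-fix a≤k)) (before-∷ʳ-bottom σ n∉σ))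
    surrogate : a ≤ k → before ρ n a ≡ before σ m a
    surrogate {a} a≤k = trans (before-demote σ n a)
      (trans (cong₂ (before (σ ∷ʳ n)) (transpose-right m n) (π-fix a≤k))
             (before-∷ʳ σ m≢n (≤m⇒≢n (m≤n⇒m≤1+n a≤k))))
    top : A m ≡ true ⊎ lastOr 0 σ ≡ m → ∀ {i} → 1 ≤ i → i ≤ k → T (tripleOK A ρ i m n)
    top (inj₁ m∈A)    _ i≤k = tripleOK-1N3 A ρ m∈A (m-bottom i≤k)
    top (inj₂ last≡m) {i} _ i≤k = tripleOK-below A ρ (trans (surrogate i≤k)
      (subst (λ x → before σ x i ≡ false) last≡m (before-lastOr 0 σ i u)))

  range-n : range n ≡ range k ++ m ∷ n ∷ []
  range-n = trans (range-suc m) (trans (cong (_∷ʳ n) (range-suc k)) (++-assoc (range k) [ m ] [ n ]))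

  extend₁-↭ : σ ↭ range m → extend₁ σ ↭ range n
  extend₁-↭ {σ} p = subst (extend₁ σ ↭_) (sym (range-suc m)) (++⁺ʳ [ n ] p)

  insertBelow-↭-range : σ ↭ range m → insertBelow m n σ ↭ range n
  insertBelow-↭-range {σ} p = ↭.trans (insertBelow-↭ σ (m∈ p)) (↭.trans (∷↭∷ʳ n σ) (extend₁-↭ p))

  demote-↭ : σ ↭ range m → demote σ ↭ range n
  demote-↭ {σ} p = begin
    map π (σ ∷ʳ n)                    ↭⟨ map⁺ π (extend₁-↭ p) ⟩
    map π (range n)                   ≡⟨ cong (map π) range-n ⟩
    map π (range k ++ m ∷ n ∷ [])     ≡⟨ map-++ π (range k) (m ∷ n ∷ []) ⟩
    map π (range k) ++ π m ∷ π n ∷ [] ≡⟨ cong₂ _++_ (map-id-local (All.tabulate (π-fix ∘ proj₂ ∘ ∈-range⁻)))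
                                                    (cong₂ (λ a b → a ∷ b ∷ []) (transpose-left m n) (transpose-right m n)) ⟩
    range k ++ n ∷ m ∷ []             ↭⟨ ++⁺ˡ (range k) (↭.swap n m ↭.refl) ⟩
    range k ++ m ∷ n ∷ []             ≡⟨ range-n ⟨
    range n                           ∎
    where open PermutationReasoning

  extend₁-∈ : σ ∈ D m A → extend₁ σ ∈ D n A
  extend₁-∈ {σ} σ∈ with ∈-D⁻ σ∈
  ... | p , S = ∈-D⁺ n A (extend₁-↭ p) (Sat-extend₁ σ S (n∉ p))

  extend₂-∈ : σ ∈ D m A → extend₂ σ ∈ D n A
  extend₂-∈ {σ} σ∈ with ∈-D⁻ σ∈ | extend₂-cases σ
  ... | p , S | inj₁ (e , demotable) =
    subst (_∈ D n A) (sym e) (∈-D⁺ n A (demote-↭ p) (Sat-demote σ S (n∉ p) (↭-range⇒Unique p) demotable))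
  ... | p , S | inj₂ (e , m∉A , _) =
    subst (_∈ D n A) (sym e) (∈-D⁺ n A (insertBelow-↭-range p) (Sat-insertBelow σ S (n∉ p) m∉A))

  lastOr-demote : ∀ σ → lastOr 0 (demote σ) ≡ m
  lastOr-demote σ = begin
    lastOr 0 (map π (σ ++ [ n ]))  ≡⟨ cong (lastOr 0) (map-++ π σ [ n ]) ⟩
    lastOr 0 (map π σ ∷ʳ π n)      ≡⟨ lastOr-∷ʳ 0 (map π σ) (π n) ⟩
    π n                            ≡⟨ transpose-right m n ⟩
    m                              ∎
    where open ≡-Reasoning

  lastOr-extend₂≢n : σ ∈ D m A → lastOr 0 (extend₂ σ) ≢ n
  lastOr-extend₂≢n {σ} σ∈ with ∈-D⁻ σ∈ | extend₂-cases σ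
  ... | _     | inj₁ (e , _) =
    subst (λ τ → lastOr 0 τ ≢ n) (sym e) (λ last≡n → m≢n (trans (sym (lastOr-demote σ)) last≡n))
  ... | p , _ | inj₂ (e , _ , last≢m) =
    subst (λ τ → lastOr 0 τ ≢ n) (sym e)
      (subst (_≢ n) (sym (lastOr-insertBelow {y = n} 0 σ last≢m)) (All.lookup (n∉ p) (lastOr-∈ 0 σ (m∈ p))))

  restore-extend₁ : All (_≢ n) σ → restore (extend₁ σ) ≡ σ
  restore-extend₁ {σ} n∉σ rewrite lastOr-∷ʳ 0 σ n | ≡ᵇ-false (m≢n ∘ sym) = delete-∷ʳ σ n∉σ

  restore-demote : All (_≢ n) σ → restore (demote σ) ≡ σ
  restore-demote {σ} n∉σ = begin
    restore (demote σ)
      ≡⟨ cong (λ b → delete n (if b then map π (demote σ) else demote σ)) (≡ᵇ-true (lastOr-demote σ)) ⟩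
    delete n (map π (map π (σ ∷ʳ n)))  ≡⟨ cong (delete n) (map-involutive (transpose-involutive m n) (σ ∷ʳ n)) ⟩
    delete n (σ ∷ʳ n)                  ≡⟨ delete-∷ʳ σ n∉σ ⟩
    σ                                  ∎
    where open ≡-Reasoning

  restore-insertBelow : All (_≢ n) σ → lastOr 0 σ ≢ m → restore (insertBelow m n σ) ≡ σ
  restore-insertBelow {σ} n∉σ last≢m rewrite lastOr-insertBelow {y = n} 0 σ last≢m | ≡ᵇ-false last≢m =
    delete-insertBelow σ n∉σ

  restore-extend₂ : σ ∈ D m A → restore (extend₂ σ) ≡ σ
  restore-extend₂ {σ} σ∈ with ∈-D⁻ σ∈ | extend₂-cases σ
  ... | p , _ | inj₁ (e , _)          = trans (cong restore e) (restore-demote (n∉ p))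
  ... | p , _ | inj₂ (e , _ , last≢m) = trans (cong restore e) (restore-insertBelow (n∉ p) last≢m)

  length-concatMap-extensions : ∀ Σ → length (concatMap extensions Σ) ≡ 2 * length Σ
  length-concatMap-extensions []      = refl
  length-concatMap-extensions (σ ∷ Σ) =
    trans (cong (suc ∘ suc) (length-concatMap-extensions Σ)) (sym (*-suc 2 (length Σ)))

  2*f≤f : 2 * f m A ≤ f n A
  2*f≤f = begin
    2 * f m A                               ≡⟨ length-concatMap-extensions (D m A) ⟨
    length (concatMap extensions (D m A))   ≤⟨ Unique⇒length≤ unique extensions⊆D ⟩
    f n A                                   ∎
    where
    open ≤-Reasoning
    restore-extensions : ∀ {σ τ} → σ ∈ D m A → τ ∈ extensions σ → restore τ ≡ σ
    restore-extensions σ∈ (here refl)         = restore-extend₁ (n∉ (proj₁ (∈-D⁻ σ∈)))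
    restore-extensions σ∈ (there (here refl)) = restore-extend₂ σ∈
    extend₁≢extend₂ : σ ∈ D m A → extend₁ σ ≢ extend₂ σ
    extend₁≢extend₂ {σ} σ∈ e = lastOr-extend₂≢n σ∈ (trans (cong (lastOr 0) (sym e)) (lastOr-∷ʳ 0 σ n))
    unique : Unique (concatMap extensions (D m A))
    unique = Unique-concatMap⁺ extensions restore (Unique-D m A)
               (λ σ∈ → (extend₁≢extend₂ σ∈ ∷ []) ∷ [] ∷ []) restore-extensions
    extensions⊆D : concatMap extensions (D m A) ⊆ D n A
    extensions⊆D τ∈ with find (∈-concatMap⁻ extensions {xs = D m A} τ∈)
    ... | _ , σ∈ , here refl         = extend₁-∈ σ∈
    ... | _ , σ∈ , there (here refl) = extend₂-∈ σ∈

2^ℓ≤f : ∀ ℓ B → 2 ^ ℓ ≤ f (suc ℓ) B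
2^ℓ≤f zero    B = s≤s z≤n  -- f 1 B evaluates to 1
2^ℓ≤f (suc ℓ) B = ≤-trans (*-monoʳ-≤ 2 (2^ℓ≤f ℓ B)) (Doubling.2*f≤f ℓ B)

mainTheorem7 : (n : ℕ) (A : ℕ → Bool) → 2 ≤ n →
    (∀ k → T (A k) → 1 ≤ k × k ≤ n) →
    f n A ≥ 2 * f (n ∸ 1) A × f n A ≥ 2 ^ (n ∸ 1)
-- f n A only reads A on [n].
mainTheorem7 (suc (suc k)) A _ _ = Doubling.2*f≤f k A , 2^ℓ≤f (suc k) A
mainTheorem7 (suc zero) A (s≤s ()) _
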